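{- Let $\mathbf{d}=(d_1,\dots,d_n)$ be a graphical sequence with $\sum_{i=1}^n d_i=4(n-1)-2$ and $d_n=2$. Then $\mathbf{d}$ admits a realization with two spanning trees that share one edge (i.e., whose edge sets have exactly one common edge).
   Context: A degree sequence is non-increasing, $d_1\ge\dots\ge d_n\ge 0$; it is graphical if some simple graph on $v_1,\dots,v_n$ has $\deg(v_i)=d_i$ (a realization). -}

module Defs where

open import Data.Bool using (Bool; true; false; if_then_else_)
open import Data.Nat using (ℕ; suc; _≤_)
open import Data.Fin using (Fin) renaming (_≤_ to _≤ᶠ_)
open import Data.List using (List; []; _∷_; _++_; [_]; length; map; allFin)
open import Data.Nat.ListAction using (sum)
open import Data.List.Relation.Unary.Linked using (Linked)
open import Data.List.Relation.Unary.Unique.Propositional using (Unique)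
open import Data.Product using (Σ; _×_; ∃)
open import Data.Sum using (_⊎_)
open import Relation.Binary.PropositionalEquality using (_≡_)
open import Relation.Nullary using (¬_)

record Graph (n : ℕ) : Set where
  field
    adj    : Fin n → Fin n → Bool
    sym    : ∀ i j → adj i j ≡ adj j i
    irrefl : ∀ i → adj i i ≡ false
open Graph public

Adj : ∀ {n} → Graph n → Fin n → Fin n → Set
Adj G i j = adj G i j ≡ true

∑ : ∀ {n} → (Fin n → ℕ) → ℕ
∑ {n} f = sum (map f (allFin n))

degree : ∀ {n} → Graph n → Fin n → ℕ
degree G i = ∑ (λ j → if adj G i j then 1 else 0)

NonIncreasing : ∀ {n} → (Fin n → ℕ) → Set
NonIncreasing d = ∀ i j → i ≤ᶠ j → d j ≤ d i

Realizes : ∀ {n} → Graph n → (Fin n → ℕ) → Set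
Realizes G d = ∀ i → degree G i ≡ d i

Graphical : ∀ {n} → (Fin n → ℕ) → Set
Graphical {n} d = Σ (Graph n) (λ G → Realizes G d)

Subgraph : ∀ {n} → Graph n → Graph n → Set
Subgraph T G = ∀ i j → Adj T i j → Adj G i j

data Walk {n} (T : Graph n) : Fin n → Fin n → Set where
  here : ∀ {u} → Walk T u u
  step : ∀ {u v w} → Adj T u v → Walk T v w → Walk T u w

Connected : ∀ {n} → Graph n → Set
Connected T = ∀ u v → Walk T u v

record Cycle {n} (T : Graph n) : Set where
  field
    v      : Fin n
    vs     : List (Fin n)
    long   : 2 ≤ length vs
    uniq   : Unique (v ∷ vs)
    closed : Linked (Adj T) (v ∷ vs ++ [ v ])

Acyclic : ∀ {n} → Graph n → Set
Acyclic T = ¬ Cycle T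

SpanningTree : ∀ {n} → Graph n → Graph n → Set
SpanningTree G T = Subgraph T G × Connected T × Acyclic T

ShareExactlyOneEdge : ∀ {n} → Graph n → Graph n → Set
ShareExactlyOneEdge {n} T₁ T₂ =
  Σ (Fin n) λ u → Σ (Fin n) λ v →
    (Adj T₁ u v × Adj T₂ u v) ×
    (∀ x y → Adj T₁ x y → Adj T₂ x y → (x ≡ u × y ≡ v) ⊎ (x ≡ v × y ≡ u))

{-# OPTIONS --safe #-}

-- Induction on n, starting from the triangle at n = 3. For n > 3 remove a vertex v with d_v = 2
-- and lower the degrees of two other vertices a ≠ b by one, choosing a and b so that the new
-- sequence again has entries in [2, n − 2], sum 4(n − 2) − 2 and an entry 2. Counting against
-- the degree sum shows such a, b exist: at most two entries equal n − 1, and if two do, all other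
-- entries are 2 and a, b are those two; otherwise a has maximum degree and b has degree 3 if
-- possible. Attaching v to a and b in a realization of the smaller sequence, the first tree grows
-- by va and the second by vb, so both stay spanning trees sharing exactly one edge. Acyclicity is
-- carried along as a ranking in which each vertex has at most one neighbour of rank ≥ its own
-- (a new leaf gets the least rank): a vertex of least rank on a cycle would have two.

module Submission where

open import Defs renaming (sym to adj-sym)
open import Data.Bool.Base using (Bool; true; false; if_then_else_; _∨_)
open import Data.Bool.Properties using (∨-zeroʳ)
open import Data.Empty using (⊥; ⊥-elim)
open import Data.Fin.Base using (Fin; zero; suc; fromℕ; punchIn; punchOut)
open import Data.Fin.Properties
  using (_≟_; any?; ≤fromℕ; punchInᵢ≢i; punchIn-injective; punchIn-punchOut; punchOut-injective)
open import Data.Fin.Permutation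
  using (Permutation; _⟨$⟩ʳ_; _⟨$⟩ˡ_; inverseˡ; inverseʳ; flip; transpose)
open import Data.List.Base using (List; []; _∷_; _++_; [_]; length; allFin)
open import Data.List.Extrema.Nat
  using (argmin; argmax; argmin-sel; f[argmin]≤f[⊤]; f[argmin]≤f[xs]; f[xs]≤f[argmax])
open import Data.List.Membership.Propositional using (_∈_)
open import Data.List.Membership.Propositional.Properties using (∈-allFin)
open import Data.List.Properties using (map-tabulate)
open import Data.List.Relation.Unary.All as All using (All; _∷_)
open import Data.List.Relation.Unary.AllPairs using (_∷_)
open import Data.List.Relation.Unary.Any using (here; there)
open import Data.List.Relation.Unary.Linked using (Linked; _∷_)
open import Data.List.Relation.Unary.Unique.Propositional using (Unique)
open import Data.Nat.Base
open import Data.Nat.ListAction using (sum)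
open import Data.Nat.Properties hiding (_≟_)
import Data.Nat.Properties as ℕ
open import Data.Nat.Tactic.RingSolver using (solve; solve-∀)
open import Data.Product using (Σ; ∃; _×_; _,_; proj₁; proj₂)
import Data.Product as Product
open import Data.Sum using (_⊎_; inj₁; inj₂)
import Data.Sum as Sum
import Data.Vec.Functional as Vector
open import Function using (_∘_; id)
open import Relation.Binary.PropositionalEquality
  using (_≡_; _≢_; refl; sym; trans; cong; cong₂; subst; subst₂; module ≡-Reasoning)
open import Relation.Nullary using (¬_; yes; no; does)
open import Relation.Nullary.Decidable using (¬?; _×-dec_; dec-true; dec-false)
import Algebra.Properties.CommutativeMonoid.Sum as CommutativeMonoidSum

module ℕ-Sum = CommutativeMonoidSum +-0-commutativeMonoid

χ : Bool → ℕ
χ b = if b then 1 else 0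

χ≤1 : ∀ b → χ b ≤ 1
χ≤1 true  = ≤-refl
χ≤1 false = z≤n

∑-suc : ∀ {n} (f : Fin (suc n) → ℕ) → ∑ f ≡ f zero + ∑ (f ∘ suc)
∑-suc f = cong (λ xs → f zero + sum xs)
  (trans (map-tabulate suc f) (sym (map-tabulate id (f ∘ suc))))

∑≡sum : ∀ {n} (f : Fin n → ℕ) → ∑ f ≡ ℕ-Sum.sum f
∑≡sum {zero}  f = refl
∑≡sum {suc n} f = trans (∑-suc f) (cong (f zero +_) (∑≡sum (f ∘ suc)))

∑-cong : ∀ {n} {f g : Fin n → ℕ} → (∀ i → f i ≡ g i) → ∑ f ≡ ∑ g
∑-cong {f = f} {g} f≗g = begin
  ∑ f          ≡⟨ ∑≡sum f ⟩
  ℕ-Sum.sum f  ≡⟨ ℕ-Sum.sum-cong-≗ f≗g ⟩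
  ℕ-Sum.sum g  ≡⟨ ∑≡sum g ⟨
  ∑ g          ∎
  where open ≡-Reasoning

∑-distrib-+ : ∀ {n} (f g : Fin n → ℕ) → ∑ (λ i → f i + g i) ≡ ∑ f + ∑ g
∑-distrib-+ f g = begin
  ∑ (λ i → f i + g i)          ≡⟨ ∑≡sum (λ i → f i + g i) ⟩
  ℕ-Sum.sum (λ i → f i + g i)  ≡⟨ ℕ-Sum.∑-distrib-+ f g ⟩
  ℕ-Sum.sum f + ℕ-Sum.sum g    ≡⟨ cong₂ _+_ (∑≡sum f) (∑≡sum g) ⟨
  ∑ f + ∑ g                    ∎
  where open ≡-Reasoning

∑-permute : ∀ {n} (f : Fin n → ℕ) (π : Permutation n n) → ∑ (f ∘ (π ⟨$⟩ʳ_)) ≡ ∑ f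
∑-permute f π = begin
  ∑ (f ∘ (π ⟨$⟩ʳ_))          ≡⟨ ∑≡sum (f ∘ (π ⟨$⟩ʳ_)) ⟩
  ℕ-Sum.sum (f ∘ (π ⟨$⟩ʳ_))  ≡⟨ ℕ-Sum.sum-permute f π ⟨
  ℕ-Sum.sum f                ≡⟨ ∑≡sum f ⟨
  ∑ f                        ∎
  where open ≡-Reasoning

∑-remove : ∀ {n} (f : Fin (suc n) → ℕ) x → ∑ f ≡ f x + ∑ (f ∘ punchIn x)
∑-remove f x = begin
  ∑ f                              ≡⟨ ∑≡sum f ⟩
  ℕ-Sum.sum f                      ≡⟨ ℕ-Sum.sum-remove f ⟩
  f x + ℕ-Sum.sum (f ∘ punchIn x)  ≡⟨ cong (f x +_) (∑≡sum (f ∘ punchIn x)) ⟨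
  f x + ∑ (f ∘ punchIn x)          ∎
  where open ≡-Reasoning

∑-mono-≤ : ∀ {n} {f g : Fin n → ℕ} → (∀ i → f i ≤ g i) → ∑ f ≤ ∑ g
∑-mono-≤ {zero}          f≤g = z≤n
∑-mono-≤ {suc n} {f} {g} f≤g = begin
  ∑ f                   ≡⟨ ∑-suc f ⟩
  f zero + ∑ (f ∘ suc)  ≤⟨ +-mono-≤ (f≤g zero) (∑-mono-≤ (f≤g ∘ suc)) ⟩
  g zero + ∑ (g ∘ suc)  ≡⟨ ∑-suc g ⟨
  ∑ g                   ∎
  where open ≤-Reasoning

∑-const : ∀ {n} c → ∑ {n} (λ _ → c) ≡ n * c
∑-const {zero}  c = refl
∑-const {suc n} c = trans (∑-suc {n} (λ _ → c)) (cong (c +_) (∑-const {n} c))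

∑-≤-except : ∀ {n c} (f : Fin (suc n) → ℕ) x → (∀ j → j ≢ x → f j ≤ c) → ∑ f ≤ f x + n * c
∑-≤-except {n} {c} f x f≤c = begin
  ∑ f                      ≡⟨ ∑-remove f x ⟩
  f x + ∑ (f ∘ punchIn x)  ≤⟨ +-monoʳ-≤ (f x) (∑-mono-≤ λ j → f≤c (punchIn x j) (punchInᵢ≢i x j)) ⟩
  f x + ∑ {n} (λ _ → c)    ≡⟨ cong (f x +_) (∑-const {n} c) ⟩
  f x + n * c              ∎
  where open ≤-Reasoning

∑-≥-except : ∀ {n c} (f : Fin (suc n) → ℕ) x → (∀ j → j ≢ x → c ≤ f j) → f x + n * c ≤ ∑ f
∑-≥-except {n} {c} f x c≤f = begin
  f x + n * c              ≡⟨ cong (f x +_) (∑-const {n} c) ⟨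
  f x + ∑ {n} (λ _ → c)    ≤⟨ +-monoʳ-≤ (f x) (∑-mono-≤ λ j → c≤f (punchIn x j) (punchInᵢ≢i x j)) ⟩
  f x + ∑ (f ∘ punchIn x)  ≡⟨ ∑-remove f x ⟨
  ∑ f                      ∎
  where open ≤-Reasoning

punchIn-≢ : ∀ {n} {x y : Fin (suc n)} (x≢y : x ≢ y) {j} → j ≢ punchOut x≢y → punchIn x j ≢ y
punchIn-≢ {x = x} x≢y j≢y′ eq =
  j≢y′ (punchIn-injective x _ _ (trans eq (sym (punchIn-punchOut x≢y))))

∑-≥-except₂ : ∀ {n c} (f : Fin (2 + n) → ℕ) {x y} → x ≢ y →
              (∀ j → j ≢ x → j ≢ y → c ≤ f j) → f x + f y + n * c ≤ ∑ f
∑-≥-except₂ {n} {c} f {x} {y} x≢y c≤f = begin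
  f x + f y + n * c           ≡⟨ +-assoc (f x) (f y) _ ⟩
  f x + (f y + n * c)         ≡⟨ cong (λ z → f x + (f z + n * c)) (punchIn-punchOut x≢y) ⟨
  f x + (f (punchIn x y′) + n * c)
    ≤⟨ +-monoʳ-≤ (f x) (∑-≥-except (f ∘ punchIn x) y′
         (λ j j≢y′ → c≤f _ (punchInᵢ≢i x j) (punchIn-≢ x≢y j≢y′))) ⟩
  f x + ∑ (f ∘ punchIn x)     ≡⟨ ∑-remove f x ⟨
  ∑ f                         ∎
  where
  open ≤-Reasoning
  y′ = punchOut x≢y

∑-≥-except₃ : ∀ {n c} (f : Fin (3 + n) → ℕ) {x y z} → x ≢ y → x ≢ z → y ≢ z →
              (∀ j → j ≢ x → j ≢ y → j ≢ z → c ≤ f j) → f x + f y + f z + n * c ≤ ∑ f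
∑-≥-except₃ {n} {c} f {x} {y} {z} x≢y x≢z y≢z c≤f = begin
  f x + f y + f z + n * c
    ≡⟨ trans (cong (_+ n * c) (+-assoc (f x) (f y) (f z))) (+-assoc (f x) (f y + f z) (n * c)) ⟩
  f x + (f y + f z + n * c)
    ≡⟨ cong₂ (λ s t → f x + (f s + f t + n * c)) (punchIn-punchOut x≢y) (punchIn-punchOut x≢z) ⟨
  f x + (f (punchIn x y′) + f (punchIn x z′) + n * c)
    ≤⟨ +-monoʳ-≤ (f x) (∑-≥-except₂ (f ∘ punchIn x) (y≢z ∘ punchOut-injective x≢y x≢z)
         λ j j≢y′ j≢z′ → c≤f _ (punchInᵢ≢i x j) (punchIn-≢ x≢y j≢y′) (punchIn-≢ x≢z j≢z′)) ⟩
  f x + ∑ (f ∘ punchIn x)     ≡⟨ ∑-remove f x ⟨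
  ∑ f                         ∎
  where
  open ≤-Reasoning
  y′ = punchOut x≢y
  z′ = punchOut x≢z

⁅_⁆ᵇ : ∀ {n} → Fin n → Fin n → Bool
⁅ a ⁆ᵇ j = does (j ≟ a)

infixr 6 _∪ᵇ_

_∪ᵇ_ : ∀ {n} → (Fin n → Bool) → (Fin n → Bool) → Fin n → Bool
(p ∪ᵇ q) j = p j ∨ q j

⁅⁆ᵇ-self : ∀ {n} (a : Fin n) → ⁅ a ⁆ᵇ a ≡ true
⁅⁆ᵇ-self a = dec-true (a ≟ a) refl

⁅⁆ᵇ-other : ∀ {n} {a j : Fin n} → j ≢ a → ⁅ a ⁆ᵇ j ≡ false
⁅⁆ᵇ-other {a = a} {j} = dec-false (j ≟ a)

⁅⁆ᵇ⇒≡ : ∀ {n} {a j : Fin n} → ⁅ a ⁆ᵇ j ≡ true → j ≡ a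
⁅⁆ᵇ⇒≡ {a = a} {j} j∈a with j ≟ a
⁅⁆ᵇ⇒≡ _  | yes j≡a = j≡a
⁅⁆ᵇ⇒≡ () | no _

⁅⁆ᵇ∪ᵇ-left : ∀ {n} (a b : Fin n) → (⁅ a ⁆ᵇ ∪ᵇ ⁅ b ⁆ᵇ) a ≡ true
⁅⁆ᵇ∪ᵇ-left a b = cong (_∨ ⁅ b ⁆ᵇ a) (⁅⁆ᵇ-self a)

⁅⁆ᵇ∪ᵇ-right : ∀ {n} (a b : Fin n) → (⁅ a ⁆ᵇ ∪ᵇ ⁅ b ⁆ᵇ) b ≡ true
⁅⁆ᵇ∪ᵇ-right a b = trans (cong (⁅ a ⁆ᵇ b ∨_) (⁅⁆ᵇ-self b)) (∨-zeroʳ (⁅ a ⁆ᵇ b))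

⁅⁆ᵇ∪ᵇ-other : ∀ {n} {a b j : Fin n} → j ≢ a → j ≢ b → (⁅ a ⁆ᵇ ∪ᵇ ⁅ b ⁆ᵇ) j ≡ false
⁅⁆ᵇ∪ᵇ-other j≢a j≢b = cong₂ _∨_ (⁅⁆ᵇ-other j≢a) (⁅⁆ᵇ-other j≢b)

∑-χ⁅⁆ᵇ : ∀ {n} (a : Fin n) → ∑ (χ ∘ ⁅ a ⁆ᵇ) ≡ 1
∑-χ⁅⁆ᵇ {suc n} a = begin
  ∑ (χ ∘ ⁅ a ⁆ᵇ)                             ≡⟨ ∑-remove (χ ∘ ⁅ a ⁆ᵇ) a ⟩
  χ (⁅ a ⁆ᵇ a) + ∑ (χ ∘ ⁅ a ⁆ᵇ ∘ punchIn a)  ≡⟨ cong₂ _+_ (cong χ (⁅⁆ᵇ-self a))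
                                                  (∑-cong λ j → cong χ (⁅⁆ᵇ-other (punchInᵢ≢i a j))) ⟩
  1 + ∑ {n} (λ _ → 0)                        ≡⟨ cong suc (trans (∑-const {n} 0) (*-zeroʳ n)) ⟩
  1                                          ∎
  where open ≡-Reasoning

χ-⁅⁆ᵇ∪ᵇ : ∀ {n} {a b : Fin n} → a ≢ b →
           ∀ j → χ ((⁅ a ⁆ᵇ ∪ᵇ ⁅ b ⁆ᵇ) j) ≡ χ (⁅ a ⁆ᵇ j) + χ (⁅ b ⁆ᵇ j)
χ-⁅⁆ᵇ∪ᵇ {a = a} {b} a≢b j with ⁅ a ⁆ᵇ j in j∈a | ⁅ b ⁆ᵇ j in j∈b
... | true  | true  = ⊥-elim (a≢b (trans (sym (⁅⁆ᵇ⇒≡ {j = j} j∈a)) (⁅⁆ᵇ⇒≡ {j = j} j∈b)))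
... | true  | false = refl
... | false | _     = refl

∑-χ-⁅⁆ᵇ∪ᵇ : ∀ {n} {a b : Fin n} → a ≢ b → ∑ (χ ∘ (⁅ a ⁆ᵇ ∪ᵇ ⁅ b ⁆ᵇ)) ≡ 2
∑-χ-⁅⁆ᵇ∪ᵇ {a = a} {b} a≢b = begin
  ∑ (χ ∘ (⁅ a ⁆ᵇ ∪ᵇ ⁅ b ⁆ᵇ))              ≡⟨ ∑-cong (χ-⁅⁆ᵇ∪ᵇ a≢b) ⟩
  ∑ (λ j → χ (⁅ a ⁆ᵇ j) + χ (⁅ b ⁆ᵇ j))  ≡⟨ ∑-distrib-+ (χ ∘ ⁅ a ⁆ᵇ) (χ ∘ ⁅ b ⁆ᵇ) ⟩
  ∑ (χ ∘ ⁅ a ⁆ᵇ) + ∑ (χ ∘ ⁅ b ⁆ᵇ)        ≡⟨ cong₂ _+_ (∑-χ⁅⁆ᵇ a) (∑-χ⁅⁆ᵇ b) ⟩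
  2                                      ∎
  where open ≡-Reasoning

degree-≤ : ∀ {m} (G : Graph (suc m)) i → degree G i ≤ m
degree-≤ {m} G i = begin
  degree G i             ≤⟨ ∑-≤-except (χ ∘ adj G i) i (λ j _ → χ≤1 (adj G i j)) ⟩
  χ (adj G i i) + m * 1  ≡⟨ cong₂ (λ b t → χ b + t) (irrefl G i) (*-identityʳ m) ⟩
  m                      ∎
  where open ≤-Reasoning

_++ʷ_ : ∀ {n} {T : Graph n} {u v w} → Walk T u v → Walk T v w → Walk T u w
here      ++ʷ q = q
step uv p ++ʷ q = step uv (p ++ʷ q)

extend : ∀ {n} → Graph n → (Fin n → Bool) → Graph (suc n)
extend {n} G p = record { adj = A ; sym = A-sym ; irrefl = A-irrefl }
  where
  A : Fin (suc n) → Fin (suc n) → Bool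
  A zero    zero    = false
  A zero    (suc j) = p j
  A (suc i) zero    = p i
  A (suc i) (suc j) = adj G i j
  A-sym : ∀ i j → A i j ≡ A j i
  A-sym zero    zero    = refl
  A-sym zero    (suc j) = refl
  A-sym (suc i) zero    = refl
  A-sym (suc i) (suc j) = adj-sym G i j
  A-irrefl : ∀ i → A i i ≡ false
  A-irrefl zero    = refl
  A-irrefl (suc i) = irrefl G i

extend-realizes : ∀ {n} {G : Graph n} {d a b} → a ≢ b → Realizes G d →
                  Realizes (extend G (⁅ a ⁆ᵇ ∪ᵇ ⁅ b ⁆ᵇ))
                           (2 Vector.∷ λ j → χ ((⁅ a ⁆ᵇ ∪ᵇ ⁅ b ⁆ᵇ) j) + d j)
extend-realizes {G = G} {a = a} {b} a≢b G⊨d zero =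
  trans (∑-suc (χ ∘ adj (extend G (⁅ a ⁆ᵇ ∪ᵇ ⁅ b ⁆ᵇ)) zero)) (∑-χ-⁅⁆ᵇ∪ᵇ a≢b)
extend-realizes {G = G} {a = a} {b} a≢b G⊨d (suc i) =
  trans (∑-suc (χ ∘ adj (extend G (⁅ a ⁆ᵇ ∪ᵇ ⁅ b ⁆ᵇ)) (suc i)))
        (cong (χ ((⁅ a ⁆ᵇ ∪ᵇ ⁅ b ⁆ᵇ) i) +_) (G⊨d i))

extend-walk : ∀ {n} {T : Graph n} {p x y} → Walk T x y → Walk (extend T p) (suc x) (suc y)
extend-walk here        = here
extend-walk (step xy w) = step xy (extend-walk w)

extend-connected : ∀ {n} {T : Graph n} {p a} → Connected T → p a ≡ true → Connected (extend T p)
extend-connected c pa zero    zero    = here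
extend-connected c pa zero    (suc y) = step pa (extend-walk (c _ y))
extend-connected c pa (suc x) zero    = extend-walk (c x _) ++ʷ step pa here
extend-connected c pa (suc x) (suc y) = extend-walk (c x y)

extend-subgraph : ∀ {n} {T G : Graph n} {p q} → Subgraph T G → (∀ j → p j ≡ true → q j ≡ true) →
                  Subgraph (extend T p) (extend G q)
extend-subgraph T⊆G p⊆q zero    zero    ()
extend-subgraph T⊆G p⊆q zero    (suc j) e = p⊆q j e
extend-subgraph T⊆G p⊆q (suc i) zero    e = p⊆q i e
extend-subgraph T⊆G p⊆q (suc i) (suc j) e = T⊆G i j e

extend-share : ∀ {n} {T₁ T₂ : Graph n} {p₁ p₂} → ShareExactlyOneEdge T₁ T₂ →
               (∀ j → p₁ j ≡ true → p₂ j ≡ true → ⊥) →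
               ShareExactlyOneEdge (extend T₁ p₁) (extend T₂ p₂)
extend-share {T₁ = T₁} {T₂} {p₁} {p₂} (u , v , uv , only-uv) disjoint = suc u , suc v , uv , only
  where
  only : ∀ x y → Adj (extend T₁ p₁) x y → Adj (extend T₂ p₂) x y →
         (x ≡ suc u × y ≡ suc v) ⊎ (x ≡ suc v × y ≡ suc u)
  only zero    zero    ()
  only zero    (suc y) e₁ e₂ = ⊥-elim (disjoint y e₁ e₂)
  only (suc x) zero    e₁ e₂ = ⊥-elim (disjoint x e₁ e₂)
  only (suc x) (suc y) e₁ e₂ =
    Sum.map (Product.map (cong suc) (cong suc)) (Product.map (cong suc) (cong suc)) (only-uv x y e₁ e₂)

relabel : ∀ {n} → Permutation n n → Graph n → Graph n
relabel σ G = record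
  { adj    = λ i j → adj G (σ ⟨$⟩ʳ i) (σ ⟨$⟩ʳ j)
  ; sym    = λ i j → adj-sym G (σ ⟨$⟩ʳ i) (σ ⟨$⟩ʳ j)
  ; irrefl = λ i → irrefl G (σ ⟨$⟩ʳ i)
  }

relabel-degree : ∀ {n} (σ : Permutation n n) (G : Graph n) i →
                 degree (relabel σ G) i ≡ degree G (σ ⟨$⟩ʳ i)
relabel-degree σ G i = ∑-permute (χ ∘ adj G (σ ⟨$⟩ʳ i)) σ

⟨$⟩ʳ≡⇒≡⟨$⟩ˡ : ∀ {n} (σ : Permutation n n) {x u} → σ ⟨$⟩ʳ x ≡ u → x ≡ σ ⟨$⟩ˡ u
⟨$⟩ʳ≡⇒≡⟨$⟩ˡ σ eq = trans (sym (inverseˡ σ)) (cong (σ ⟨$⟩ˡ_) eq)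

relabel-adj : ∀ {n} (σ : Permutation n n) {G : Graph n} {u v} →
              Adj G u v → Adj (relabel σ G) (σ ⟨$⟩ˡ u) (σ ⟨$⟩ˡ v)
relabel-adj σ {G} = subst₂ (Adj G) (sym (inverseʳ σ)) (sym (inverseʳ σ))

relabel-walk : ∀ {n} (σ : Permutation n n) {T : Graph n} {u v} →
               Walk T u v → Walk (relabel σ T) (σ ⟨$⟩ˡ u) (σ ⟨$⟩ˡ v)
relabel-walk σ     here        = here
relabel-walk σ {T} (step uv w) = step (relabel-adj σ {T} uv) (relabel-walk σ w)

relabel-connected : ∀ {n} (σ : Permutation n n) {T : Graph n} → Connected T → Connected (relabel σ T)
relabel-connected σ {T} c u v =
  subst₂ (Walk (relabel σ T)) (inverseˡ σ) (inverseˡ σ) (relabel-walk σ (c (σ ⟨$⟩ʳ u) (σ ⟨$⟩ʳ v)))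

relabel-share : ∀ {n} (σ : Permutation n n) {T₁ T₂ : Graph n} → ShareExactlyOneEdge T₁ T₂ →
                ShareExactlyOneEdge (relabel σ T₁) (relabel σ T₂)
relabel-share σ {T₁} {T₂} (u , v , (uv₁ , uv₂) , only-uv) =
  σ ⟨$⟩ˡ u , σ ⟨$⟩ˡ v , (relabel-adj σ {T₁} uv₁ , relabel-adj σ {T₂} uv₂) ,
  λ x y e₁ e₂ → Sum.map (Product.map (⟨$⟩ʳ≡⇒≡⟨$⟩ˡ σ) (⟨$⟩ʳ≡⇒≡⟨$⟩ˡ σ))
                        (Product.map (⟨$⟩ʳ≡⇒≡⟨$⟩ˡ σ) (⟨$⟩ʳ≡⇒≡⟨$⟩ˡ σ))
                        (only-uv (σ ⟨$⟩ʳ x) (σ ⟨$⟩ʳ y) e₁ e₂)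

lastOf : ∀ {A : Set} → A → List A → A
lastOf w []       = w
lastOf w (u ∷ us) = lastOf u us

All-lastOf : ∀ {A : Set} {P : A → Set} w ws → All P (w ∷ ws) → P (lastOf w ws)
All-lastOf w []       (pw ∷ _)   = pw
All-lastOf w (u ∷ us) (_ ∷ pus) = All-lastOf u us pus

record Flanked {A : Set} (R : A → A → Set) (P : A → Set) (x : A) : Set where
  field
    before after : A
    before≢after : before ≢ after
    R-before     : R before x
    R-after      : R x after
    P-before     : P before
    P-after      : P after

module _ {A : Set} {R : A → A → Set} {P : A → Set} where

  R-lastOf : ∀ {v} w ws → Linked R (w ∷ ws ++ [ v ]) → R (lastOf w ws) v
  R-lastOf w []       (wRv ∷ _) = wRv
  R-lastOf w (u ∷ us) (_ ∷ lk)  = R-lastOf u us lk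

  flanked-on-path : ∀ {v x} u ws → All (_≢ v) (u ∷ ws) → Unique (u ∷ ws) →
                    Linked R (u ∷ ws ++ [ v ]) → P v → All P (u ∷ ws) → x ∈ ws → Flanked R P x
  flanked-on-path {v} u (w ∷ []) (u≢v ∷ _) _ (uRw ∷ wRv ∷ _) Pv (Pu ∷ _) (here refl) = record
    { before = u ; after = v ; before≢after = u≢v
    ; R-before = uRw ; R-after = wRv ; P-before = Pu ; P-after = Pv }
  flanked-on-path u (w ∷ w′ ∷ ws) _ ((_ ∷ u≢w′ ∷ _) ∷ _) (uRw ∷ wRw′ ∷ _) _ (Pu ∷ _ ∷ Pw′ ∷ _)
                  (here refl) = record
    { before = u ; after = w′ ; before≢after = u≢w′
    ; R-before = uRw ; R-after = wRw′ ; P-before = Pu ; P-after = Pw′ }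
  flanked-on-path u (w ∷ ws) (_ ∷ ≢v) (_ ∷ uniq) (_ ∷ lk) Pv (_ ∷ Pws) (there x∈ws) =
    flanked-on-path w ws ≢v uniq lk Pv Pws x∈ws

  flanked-on-cycle : ∀ {x} v vs → 2 ≤ length vs → Unique (v ∷ vs) → Linked R (v ∷ vs ++ [ v ]) →
                     All P (v ∷ vs) → x ∈ v ∷ vs → Flanked R P x
  flanked-on-cycle v []       ()
  flanked-on-cycle v (_ ∷ []) (s≤s ())
  flanked-on-cycle v (p ∷ q ∷ rest) _ (_ ∷ (p≢ ∷ _)) (vRp ∷ _ ∷ lk) (_ ∷ Pp ∷ Pq∷rest) (here refl) = record
    { before = lastOf q rest ; after = p ; before≢after = All-lastOf q rest p≢ ∘ sym
    ; R-before = R-lastOf q rest lk ; R-after = vRp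
    ; P-before = All-lastOf q rest Pq∷rest ; P-after = Pp }
  flanked-on-cycle v (p ∷ q ∷ rest) _ ((_ ∷ v≢q ∷ _) ∷ _) (vRp ∷ pRq ∷ _) (Pv ∷ _ ∷ Pq ∷ _)
                   (there (here refl)) = record
    { before = v ; after = q ; before≢after = v≢q
    ; R-before = vRp ; R-after = pRq ; P-before = Pv ; P-after = Pq }
  flanked-on-cycle v (p ∷ q ∷ rest) _ (v≢ ∷ uniq) (_ ∷ lk) (Pv ∷ Ps) (there (there x∈q∷rest)) =
    flanked-on-path p (q ∷ rest) (All.map (_∘ sym) v≢) uniq lk Pv Ps x∈q∷rest

ForestRanking : ∀ {n} → Graph n → (Fin n → ℕ) → Set
ForestRanking T r = ∀ x y z → Adj T x y → Adj T x z → r x ≤ r y → r x ≤ r z → y ≡ z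

forestRanking⇒acyclic : ∀ {n} {T : Graph n} {r} → ForestRanking T r → Acyclic T
forestRanking⇒acyclic {T = T} {r} rank-ok c =
  before≢after (rank-ok x before after (trans (adj-sym T x before) R-before) R-after P-before P-after)
  where
  open Cycle c
  x = argmin r v vs
  x∈cycle : x ∈ v ∷ vs
  x∈cycle = Sum.[ here , there ]′ (argmin-sel r v vs)
  open Flanked (flanked-on-cycle {P = λ y → r x ≤ r y} v vs long uniq closed
                  (f[argmin]≤f[⊤] {f = r} v vs ∷ f[argmin]≤f[xs] {f = r} v vs) x∈cycle)

extend-forestRanking : ∀ {n} {T : Graph n} {r a} → ForestRanking T r →
                       ForestRanking (extend T ⁅ a ⁆ᵇ) (0 Vector.∷ suc ∘ r)
extend-forestRanking rank-ok zero    (suc y) (suc z) y∈a z∈a _ _ =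
  cong suc (trans (⁅⁆ᵇ⇒≡ {j = y} y∈a) (sym (⁅⁆ᵇ⇒≡ {j = z} z∈a)))
extend-forestRanking rank-ok (suc x) (suc y) (suc z) xy xz rx≤ry rx≤rz =
  cong suc (rank-ok x y z xy xz (s≤s⁻¹ rx≤ry) (s≤s⁻¹ rx≤rz))
extend-forestRanking rank-ok zero    zero    _       ()
extend-forestRanking rank-ok zero    (suc y) zero    _  ()
extend-forestRanking rank-ok (suc x) zero    _       _  _  ()
extend-forestRanking rank-ok (suc x) (suc y) zero    _  _  _  ()

relabel-forestRanking : ∀ {n} (σ : Permutation n n) {T : Graph n} {r} → ForestRanking T r →
                        ForestRanking (relabel σ T) (r ∘ (σ ⟨$⟩ʳ_))
relabel-forestRanking σ rank-ok x y z xy xz rx≤ry rx≤rz =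
  trans (⟨$⟩ʳ≡⇒≡⟨$⟩ˡ σ (rank-ok _ _ _ xy xz rx≤ry rx≤rz)) (inverseˡ σ)

record RankedSpanningTree {n} (G : Graph n) : Set where
  field
    tree      : Graph n
    subgraph  : Subgraph tree G
    connected : Connected tree
    rank      : Fin n → ℕ
    ranking   : ForestRanking tree rank

spanningTree : ∀ {n} {G : Graph n} (t : RankedSpanningTree G) → SpanningTree G (RankedSpanningTree.tree t)
spanningTree t = subgraph , connected , forestRanking⇒acyclic ranking
  where open RankedSpanningTree t

attach : ∀ {n} {G : Graph n} {p} → RankedSpanningTree G → ∀ a → p a ≡ true →
         RankedSpanningTree (extend G p)
attach {p = p} t a pa = record
  { tree      = extend tree ⁅ a ⁆ᵇ
  ; subgraph  = extend-subgraph subgraph λ j j∈a → subst (λ i → p i ≡ true) (sym (⁅⁆ᵇ⇒≡ {j = j} j∈a)) pa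
  ; connected = extend-connected {a = a} connected (⁅⁆ᵇ-self a)
  ; rank      = 0 Vector.∷ suc ∘ rank
  ; ranking   = extend-forestRanking ranking
  }
  where open RankedSpanningTree t

relabel-tree : ∀ {n} {G : Graph n} (σ : Permutation n n) →
               RankedSpanningTree G → RankedSpanningTree (relabel σ G)
relabel-tree σ t = record
  { tree      = relabel σ tree
  ; subgraph  = λ i j → subgraph (σ ⟨$⟩ʳ i) (σ ⟨$⟩ʳ j)
  ; connected = relabel-connected σ connected
  ; rank      = rank ∘ (σ ⟨$⟩ʳ_)
  ; ranking   = relabel-forestRanking σ {tree} ranking
  }
  where open RankedSpanningTree t

record TwoTreesSharingOneEdge {n} (G : Graph n) : Set where
  field
    first second : RankedSpanningTree G
    share        : ShareExactlyOneEdge (RankedSpanningTree.tree first) (RankedSpanningTree.tree second)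

extend-twoTrees : ∀ {n} {G : Graph n} {a b} → a ≢ b → TwoTreesSharingOneEdge G →
                  TwoTreesSharingOneEdge (extend G (⁅ a ⁆ᵇ ∪ᵇ ⁅ b ⁆ᵇ))
extend-twoTrees {a = a} {b} a≢b t = record
  { first  = attach first a (⁅⁆ᵇ∪ᵇ-left a b)
  ; second = attach second b (⁅⁆ᵇ∪ᵇ-right a b)
  ; share  = extend-share share λ j j∈a j∈b → a≢b (trans (sym (⁅⁆ᵇ⇒≡ {j = j} j∈a)) (⁅⁆ᵇ⇒≡ {j = j} j∈b))
  }
  where open TwoTreesSharingOneEdge t

relabel-twoTrees : ∀ {n} {G : Graph n} (σ : Permutation n n) → TwoTreesSharingOneEdge G →
                   TwoTreesSharingOneEdge (relabel σ G)
relabel-twoTrees σ t = record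
  { first  = relabel-tree σ first
  ; second = relabel-tree σ second
  ; share  = relabel-share σ {RankedSpanningTree.tree first} {RankedSpanningTree.tree second} share
  }
  where open TwoTreesSharingOneEdge t

TwoTreeRealization : ∀ {n} → (Fin n → ℕ) → Set
TwoTreeRealization {n} d = Σ (Graph n) λ G → Realizes G d × TwoTreesSharingOneEdge G

realization-cong : ∀ {n} {d d′ : Fin n → ℕ} → (∀ i → d i ≡ d′ i) →
                   TwoTreeRealization d → TwoTreeRealization d′
realization-cong d≗d′ (G , G⊨d , t) = G , (λ i → trans (G⊨d i) (d≗d′ i)) , t

extend-realization : ∀ {n} {d : Fin n → ℕ} {a b} → a ≢ b → TwoTreeRealization d →
                     TwoTreeRealization (2 Vector.∷ λ j → χ ((⁅ a ⁆ᵇ ∪ᵇ ⁅ b ⁆ᵇ) j) + d j)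
extend-realization a≢b (G , G⊨d , t) = extend G _ , extend-realizes a≢b G⊨d , extend-twoTrees a≢b t

unpermute-realization : ∀ {n} {d : Fin n → ℕ} (π : Permutation n n) →
                        TwoTreeRealization (d ∘ (π ⟨$⟩ʳ_)) → TwoTreeRealization d
unpermute-realization {d = d} π (G , G⊨dπ , t) = relabel (flip π) G , G′⊨d , relabel-twoTrees (flip π) t
  where
  open ≡-Reasoning
  G′⊨d : Realizes (relabel (flip π) G) d
  G′⊨d i = begin
    degree (relabel (flip π) G) i  ≡⟨ relabel-degree (flip π) G i ⟩
    degree G (π ⟨$⟩ˡ i)            ≡⟨ G⊨dπ (π ⟨$⟩ˡ i) ⟩
    d (π ⟨$⟩ʳ (π ⟨$⟩ˡ i))          ≡⟨ cong d (inverseʳ π) ⟩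
    d i                            ∎

point : Graph 1
point = record { adj = λ _ _ → false ; sym = λ _ _ → refl ; irrefl = λ _ → refl }

point-tree : RankedSpanningTree point
point-tree = record
  { tree      = point
  ; subgraph  = λ _ _ e → e
  ; connected = λ { zero zero → here }
  ; rank      = λ _ → 0
  ; ranking   = λ _ _ _ ()
  }

edge : Graph 2
edge = extend point ⁅ zero ⁆ᵇ

edge-shared : ShareExactlyOneEdge edge edge
edge-shared = zero , suc zero , (refl , refl) , only
  where
  only : ∀ x y → Adj edge x y → Adj edge x y →
         (x ≡ zero × y ≡ suc zero) ⊎ (x ≡ suc zero × y ≡ zero)
  only zero       (suc zero) _ _ = inj₁ (refl , refl)
  only (suc zero) zero       _ _ = inj₂ (refl , refl)
  only zero       zero       ()
  only (suc zero) (suc zero) ()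

edge-realization : TwoTreeRealization {2} (λ _ → 1)
edge-realization = edge , (λ { zero → refl ; (suc zero) → refl }) , record
  { first  = attach point-tree zero refl
  ; second = attach point-tree zero refl
  ; share  = edge-shared
  }

triangle-realization : TwoTreeRealization {3} (λ _ → 2)
triangle-realization = realization-cong (λ { zero → refl ; (suc zero) → refl ; (suc (suc zero)) → refl })
  (extend-realization {a = zero} {b = suc zero} (λ ()) edge-realization)

-- The hypotheses of the theorem for n = 3 + k vertices, weakened: graphicality to d_i ≤ n − 1,
-- monotonicity dropped, and d_n = 2 to d_v = 2 for some v.
record Admissible (k : ℕ) (d : Fin (3 + k) → ℕ) : Set where
  field
    lower-bound : ∀ i → 2 ≤ d i
    upper-bound : ∀ i → d i ≤ 2 + k
    total       : ∑ d + 6 ≡ 4 * (3 + k)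
    has-two     : ∃ λ v → d v ≡ 2

-- e is what remains of a sequence on 4 + k vertices after deleting a vertex of degree 2, which is
-- to be re-attached to a and b.
record Pivots {k} (e : Fin (3 + k) → ℕ) : Set where
  field
    a b          : Fin (3 + k)
    a≢b          : a ≢ b
    3≤e[a]       : 3 ≤ e a
    3≤e[b]       : 3 ≤ e b
    others-≢full : ∀ j → j ≢ a → j ≢ b → e j ≢ 3 + k
    two-remains  : (∃ λ w → w ≢ a × w ≢ b × e w ≡ 2) ⊎ e b ≡ 3

record Lowering {k} (e : Fin (3 + k) → ℕ) : Set where
  field
    a b        : Fin (3 + k)
    a≢b        : a ≢ b
    rest       : Fin (3 + k) → ℕ
    split      : ∀ j → e j ≡ χ ((⁅ a ⁆ᵇ ∪ᵇ ⁅ b ⁆ᵇ) j) + rest j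
    admissible : Admissible k rest

third : ∀ {k} {c c′ : Fin (3 + k)} → c ≢ c′ → ∃ λ w → w ≢ c × w ≢ c′
third {c = c} c≢c′ = punchIn c w′ , punchInᵢ≢i c w′ , punchIn-≢ c≢c′ (punchInᵢ≢i c′₀ zero)
  where
  c′₀ = punchOut c≢c′
  w′  = punchIn c′₀ zero

module _ {k : ℕ} {e : Fin (3 + k) → ℕ}
         (2≤e : ∀ j → 2 ≤ e j) (e≤3+k : ∀ j → e j ≤ 3 + k) (∑e : ∑ e + 4 ≡ 4 * (3 + k)) where

  sum-too-large : ∀ {L} → L ≤ ∑ e → 4 * (3 + k) < L + 4 → ⊥
  sum-too-large {L} L≤∑e <L+4 = <-irrefl refl (begin-strict
    4 * (3 + k)  <⟨ <L+4 ⟩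
    L + 4        ≤⟨ +-monoˡ-≤ 4 L≤∑e ⟩
    ∑ e + 4      ≡⟨ ∑e ⟩
    4 * (3 + k)  ∎)
    where open ≤-Reasoning

  sum-too-small : ∀ {U} → ∑ e ≤ U → U + 4 < 4 * (3 + k) → ⊥
  sum-too-small {U} ∑e≤U U+4< = <-irrefl refl (begin-strict
    4 * (3 + k)  ≡⟨ ∑e ⟨
    ∑ e + 4      ≤⟨ +-monoˡ-≤ 4 ∑e≤U ⟩
    U + 4        <⟨ U+4< ⟩
    4 * (3 + k)  ∎)
    where open ≤-Reasoning

  no-third-large : ∀ {c c′ w} → c ≢ c′ → c ≢ w → c′ ≢ w →
                   e c ≡ 3 + k → e c′ ≡ 3 + k → 3 ≤ e w → ⊥
  no-third-large {c} {c′} {w} c≢c′ c≢w c′≢w full-c full-c′ 3≤e[w] = sum-too-large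
    (begin
      (3 + k) + (3 + k) + 3 + k * 2  ≤⟨ +-monoˡ-≤ (k * 2)
                                          (+-mono-≤ (≤-reflexive (cong₂ _+_ (sym full-c) (sym full-c′))) 3≤e[w]) ⟩
      e c + e c′ + e w + k * 2       ≤⟨ ∑-≥-except₃ e c≢c′ c≢w c′≢w (λ j _ _ _ → 2≤e j) ⟩
      ∑ e                            ∎)
    (≤-reflexive (solve [ k ]))
    where open ≤-Reasoning

  some-other-large : ∀ a → ∃ λ b → b ≢ a × 3 ≤ e b
  some-other-large a with any? (λ b → ¬? (b ≟ a) ×-dec (3 ≤? e b))
  ... | yes found = found
  ... | no ∄large = ⊥-elim (sum-too-small
    (begin
      ∑ e                  ≤⟨ ∑-≤-except e a (λ j j≢a → s≤s⁻¹ (≰⇒> λ 3≤e[j] → ∄large (j , j≢a , 3≤e[j]))) ⟩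
      e a + (2 + k) * 2    ≤⟨ +-monoˡ-≤ ((2 + k) * 2) (e≤3+k a) ⟩
      3 + k + (2 + k) * 2  ∎)
    (≤-trans (m≤m+n _ k) (≤-reflexive (solve [ k ]))))
    where open ≤-Reasoning

  two-or-three : ∀ a → 3 ≤ e a → (∃ λ w → e w ≡ 2) ⊎ (∃ λ w → w ≢ a × e w ≡ 3)
  two-or-three a 3≤e[a] with any? (λ w → e w ℕ.≟ 2) | any? (λ w → ¬? (w ≟ a) ×-dec (e w ℕ.≟ 3))
  ... | yes two | _         = inj₁ two
  ... | no _    | yes three = inj₂ three
  ... | no ∄two | no ∄three = ⊥-elim (sum-too-large
    (begin
      3 + (2 + k) * 4    ≤⟨ +-monoˡ-≤ ((2 + k) * 4) 3≤e[a] ⟩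
      e a + (2 + k) * 4  ≤⟨ ∑-≥-except e a 4≤e ⟩
      ∑ e                ∎)
    (≤-trans (m≤m+n _ 2) (≤-reflexive (solve [ k ]))))
    where
    open ≤-Reasoning
    4≤e : ∀ j → j ≢ a → 4 ≤ e j
    4≤e j j≢a = ≤∧≢⇒< (≤∧≢⇒< (2≤e j) λ 2≡e[j] → ∄two (j , sym 2≡e[j]))
                       λ 3≡e[j] → ∄three (j , j≢a , sym 3≡e[j])

  two-full-pivots : ∀ {c c′} → c ≢ c′ → e c ≡ 3 + k → e c′ ≡ 3 + k → Pivots e
  two-full-pivots {c} {c′} c≢c′ full-c full-c′ with third c≢c′
  ... | w , w≢c , w≢c′ = record
    { a = c ; b = c′ ; a≢b = c≢c′
    ; 3≤e[a] = 3≤full full-c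
    ; 3≤e[b] = 3≤full full-c′
    ; others-≢full = λ j j≢c j≢c′ full-j →
        no-third-large c≢c′ (j≢c ∘ sym) (j≢c′ ∘ sym) full-c full-c′ (3≤full full-j)
    ; two-remains = inj₁ (w , w≢c , w≢c′ , ≤-antisym e[w]≤2 (2≤e w))
    }
    where
    3≤full : ∀ {j} → e j ≡ 3 + k → 3 ≤ e j
    3≤full full-j = subst (3 ≤_) (sym full-j) (m≤m+n 3 k)
    e[w]≤2 : e w ≤ 2
    e[w]≤2 = s≤s⁻¹ (≰⇒> (no-third-large c≢c′ (w≢c ∘ sym) (w≢c′ ∘ sym) full-c full-c′))

  jmax : Fin (3 + k)
  jmax = argmax e zero (allFin (3 + k))

  e≤e[jmax] : ∀ j → e j ≤ e jmax
  e≤e[jmax] j = All.lookup (f[xs]≤f[argmax] {f = e} zero (allFin (3 + k))) (∈-allFin j)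

  max-pivots : ¬ (∃ λ c → ∃ λ c′ → c ≢ c′ × e c ≡ 3 + k × e c′ ≡ 3 + k) →
               (∃ λ b → b ≢ jmax × 3 ≤ e b) → Pivots e
  max-pivots ∄two-full (b₀ , b₀≢a , 3≤e[b₀]) = pivots-by (two-or-three jmax 3≤e[a])
    where
    a = jmax
    3≤e[a] : 3 ≤ e a
    3≤e[a] = ≤-trans 3≤e[b₀] (e≤e[jmax] b₀)
    others-≢full : ∀ j → j ≢ a → e j ≢ 3 + k
    others-≢full j j≢a full-j =
      ∄two-full (a , j , j≢a ∘ sym , ≤-antisym (e≤3+k a) (subst (_≤ e a) full-j (e≤e[jmax] j)) , full-j)
    pivots-with : ∀ {b} → b ≢ a → 3 ≤ e b → (∃ λ w → w ≢ a × w ≢ b × e w ≡ 2) ⊎ e b ≡ 3 → Pivots e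
    pivots-with {b} b≢a 3≤e[b] two = record
      { a = a ; b = b ; a≢b = b≢a ∘ sym ; 3≤e[a] = 3≤e[a] ; 3≤e[b] = 3≤e[b]
      ; others-≢full = λ j j≢a _ → others-≢full j j≢a ; two-remains = two }
    pivots-by : (∃ λ w → e w ≡ 2) ⊎ (∃ λ w → w ≢ a × e w ≡ 3) → Pivots e
    pivots-by (inj₂ (w , w≢a , e[w]≡3)) = pivots-with w≢a (≤-reflexive (sym e[w]≡3)) (inj₂ e[w]≡3)
    pivots-by (inj₁ (w , e[w]≡2))       =
      pivots-with b₀≢a 3≤e[b₀] (inj₁ (w , small≢ 3≤e[a] , small≢ 3≤e[b₀] , e[w]≡2))
      where
      small≢ : ∀ {x} → 3 ≤ e x → w ≢ x
      small≢ 3≤e[x] refl = <⇒≱ ≤-refl (subst (3 ≤_) e[w]≡2 3≤e[x])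

  pivots : Pivots e
  pivots with any? (λ c → any? λ c′ → ¬? (c ≟ c′) ×-dec (e c ℕ.≟ 3 + k) ×-dec (e c′ ℕ.≟ 3 + k))
  ... | yes (c , c′ , c≢c′ , full-c , full-c′) = two-full-pivots c≢c′ full-c full-c′
  ... | no ∄two-full                           = max-pivots ∄two-full (some-other-large jmax)

  lower-pivots : Pivots e → Lowering e
  lower-pivots pivots = record
    { a = a ; b = b ; a≢b = a≢b ; rest = rest
    ; split = λ j → sym (m+[n∸m]≡n (δ≤e j))
    ; admissible = record { lower-bound = lower ; upper-bound = upper ; total = total ; has-two = has-two }
    }
    where
    open Pivots pivots
    δ : Fin (3 + k) → ℕ
    δ j = χ ((⁅ a ⁆ᵇ ∪ᵇ ⁅ b ⁆ᵇ) j)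
    rest : Fin (3 + k) → ℕ
    rest j = e j ∸ δ j
    δ≤e : ∀ j → δ j ≤ e j
    δ≤e j = ≤-trans (χ≤1 _) (≤-trans (s≤s z≤n) (2≤e j))
    pivot-or-not : ∀ j → j ≡ a ⊎ j ≡ b ⊎ (j ≢ a × j ≢ b)
    pivot-or-not j with j ≟ a | j ≟ b
    ... | yes j≡a | _       = inj₁ j≡a
    ... | no _    | yes j≡b = inj₂ (inj₁ j≡b)
    ... | no j≢a  | no j≢b  = inj₂ (inj₂ (j≢a , j≢b))
    rest-at-a : rest a ≡ e a ∸ 1
    rest-at-a = cong (λ t → e a ∸ χ t) (⁅⁆ᵇ∪ᵇ-left a b)
    rest-at-b : rest b ≡ e b ∸ 1
    rest-at-b = cong (λ t → e b ∸ χ t) (⁅⁆ᵇ∪ᵇ-right a b)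
    rest-elsewhere : ∀ {j} → j ≢ a → j ≢ b → rest j ≡ e j
    rest-elsewhere {j} j≢a j≢b = cong (λ t → e j ∸ χ t) (⁅⁆ᵇ∪ᵇ-other j≢a j≢b)
    lower : ∀ j → 2 ≤ rest j
    lower j with pivot-or-not j
    ... | inj₁ refl               = subst (2 ≤_) (sym rest-at-a) (∸-monoˡ-≤ 1 3≤e[a])
    ... | inj₂ (inj₁ refl)        = subst (2 ≤_) (sym rest-at-b) (∸-monoˡ-≤ 1 3≤e[b])
    ... | inj₂ (inj₂ (j≢a , j≢b)) = subst (2 ≤_) (sym (rest-elsewhere j≢a j≢b)) (2≤e j)
    upper : ∀ j → rest j ≤ 2 + k
    upper j with pivot-or-not j
    ... | inj₁ refl               = subst (_≤ 2 + k) (sym rest-at-a) (∸-monoˡ-≤ 1 (e≤3+k a))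
    ... | inj₂ (inj₁ refl)        = subst (_≤ 2 + k) (sym rest-at-b) (∸-monoˡ-≤ 1 (e≤3+k b))
    ... | inj₂ (inj₂ (j≢a , j≢b)) = subst (_≤ 2 + k) (sym (rest-elsewhere j≢a j≢b))
                                      (s≤s⁻¹ (≤∧≢⇒< (e≤3+k j) (others-≢full j j≢a j≢b)))
    total : ∑ rest + 6 ≡ 4 * (3 + k)
    total = begin
      ∑ rest + 6                  ≡⟨ +-assoc (∑ rest) 2 4 ⟨
      ∑ rest + 2 + 4              ≡⟨ cong (λ t → ∑ rest + t + 4) (∑-χ-⁅⁆ᵇ∪ᵇ a≢b) ⟨
      ∑ rest + ∑ δ + 4            ≡⟨ cong (_+ 4) (∑-distrib-+ rest δ) ⟨
      ∑ (λ j → rest j + δ j) + 4  ≡⟨ cong (_+ 4) (∑-cong (λ j → m∸n+n≡m (δ≤e j))) ⟩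
      ∑ e + 4                     ≡⟨ ∑e ⟩
      4 * (3 + k)                 ∎
      where open ≡-Reasoning
    has-two : ∃ λ w → rest w ≡ 2
    has-two with two-remains
    ... | inj₁ (w , w≢a , w≢b , e[w]≡2) = w , trans (rest-elsewhere w≢a w≢b) e[w]≡2
    ... | inj₂ e[b]≡3                   = b , trans rest-at-b (cong (_∸ 1) e[b]≡3)

  lowering : Lowering e
  lowering = lower-pivots pivots

admissible-realization : ∀ k {d : Fin (3 + k) → ℕ} → Admissible k d → TwoTreeRealization d
admissible-realization zero adm =
  realization-cong (λ i → ≤-antisym (lower-bound i) (upper-bound i)) triangle-realization
  where open Admissible adm
admissible-realization (suc k) {d} adm =
  unpermute-realization π
    (realization-cong d∘π (extend-realization a≢b (admissible-realization k admissible)))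
  where
  open Admissible adm
  v = proj₁ has-two
  π = transpose zero v
  e : Fin (3 + k) → ℕ
  e j = d (π ⟨$⟩ʳ suc j)
  ∑e : ∑ e + 4 ≡ 4 * (3 + k)
  ∑e = +-cancelˡ-≡ 4 _ _ (begin
    4 + (∑ e + 4)            ≡⟨ rearrange (∑ e) ⟩
    2 + ∑ e + 6              ≡⟨ cong (λ t → t + ∑ e + 6) (proj₂ has-two) ⟨
    d v + ∑ e + 6            ≡⟨ cong (_+ 6) (∑-suc (d ∘ (π ⟨$⟩ʳ_))) ⟨
    ∑ (d ∘ (π ⟨$⟩ʳ_)) + 6    ≡⟨ cong (_+ 6) (∑-permute d π) ⟩
    ∑ d + 6                  ≡⟨ total ⟩
    4 * (4 + k)              ≡⟨ *-suc 4 (3 + k) ⟩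
    4 + 4 * (3 + k)          ∎)
    where
    open ≡-Reasoning
    rearrange : ∀ s → 4 + (s + 4) ≡ 2 + s + 6
    rearrange = solve-∀
  open Lowering (lowering (λ j → lower-bound _) (λ j → upper-bound _) ∑e)
  d∘π : ∀ i → (2 Vector.∷ λ j → χ ((⁅ a ⁆ᵇ ∪ᵇ ⁅ b ⁆ᵇ) j) + rest j) i ≡ d (π ⟨$⟩ʳ i)
  d∘π zero    = sym (proj₂ has-two)
  d∘π (suc j) = sym (split j)

lemma3p7 : (m : ℕ) (d : Fin (suc m) → ℕ) →
    NonIncreasing d → Graphical d →
    ∑ d + 2 ≡ 4 * m → d (fromℕ m) ≡ 2 →
    Σ (Graph (suc m)) λ G → Realizes G d ×
      Σ (Graph (suc m)) λ T₁ → Σ (Graph (suc m)) λ T₂ →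
        SpanningTree G T₁ × SpanningTree G T₂ × ShareExactlyOneEdge T₁ T₂
lemma3p7 zero d _ _ ∑d+2≡0 _ = ⊥-elim (1+n≢0 (trans (+-comm 2 (∑ d)) ∑d+2≡0))
lemma3p7 (suc zero) d _ (G , G⊨d) _ d[last]≡2 =
  ⊥-elim (<⇒≱ ≤-refl (subst (_≤ 1) (trans (G⊨d (fromℕ 1)) d[last]≡2) (degree-≤ G (fromℕ 1))))
lemma3p7 (suc (suc k)) d non-increasing (G , G⊨d) ∑d+2≡ d[last]≡2 =
  let H , H⊨d , trees = admissible-realization k adm
      open TwoTreesSharingOneEdge trees
  in H , H⊨d , _ , _ , spanningTree first , spanningTree second , share
  where
  adm : Admissible k d
  adm = record
    { lower-bound = λ i → subst (_≤ d i) d[last]≡2 (non-increasing i (fromℕ _) (≤fromℕ i))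
    ; upper-bound = λ i → subst (_≤ 2 + k) (G⊨d i) (degree-≤ G i)
    ; total       = begin
        ∑ d + 6          ≡⟨ +-assoc (∑ d) 2 4 ⟨
        ∑ d + 2 + 4      ≡⟨ cong (_+ 4) ∑d+2≡ ⟩
        4 * (2 + k) + 4  ≡⟨ +-comm (4 * (2 + k)) 4 ⟩
        4 + 4 * (2 + k)  ≡⟨ *-suc 4 (2 + k) ⟨
        4 * (3 + k)      ∎
    ; has-two     = fromℕ _ , d[last]≡2
    }
    where open ≡-Reasoning
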